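{- Let $n$ and $k$ be positive integers. The equation $(k!)^n+k^{n!}=(n!)^k+n^{k!}$ holds if and only if $k=n$. -}

{-# OPTIONS --safe #-}
module Submission where

-- By symmetry it suffices to show that the two sides differ when 1 ≤ k < n.
-- For k = 1 the left side is 2 while the right side is n! + n.  For 2 ≤ k < n
-- the term k^(n!) alone exceeds the right side: with m = n - 1 ≥ 4 and F = m!
-- one has n ≤ 2^m and m n ≤ F, so both (n!)^k ≤ (n^n)^m ≤ n^F and n^(k!) ≤ n^F
-- are at most 2^(m F), and their sum is at most 2^(m F + 1) < 2^(m F + F) = 2^(n!).
-- The cases n ≤ 4 are checked by computation.

open import Data.Nat.Base
open import Data.Nat.Properties
open import Data.Unit.Base using (tt)
open import Relation.Binary.PropositionalEquality using (_≡_; _≢_; refl; sym; cong; cong₂)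
open import Relation.Binary.Definitions using (tri<; tri≈; tri>)
open import Function.Base using (_∘′_)
open import Function.Bundles using (_⇔_; mk⇔)
open import Relation.Nullary.Negation using (contradiction)

!-mono-≤ : ∀ {m n} → m ≤ n → m ! ≤ n !
!-mono-≤ = mono′ ∘′ ≤⇒≤′
  where
  mono′ : ∀ {m n} → m ≤′ n → m ! ≤ n !
  mono′ ≤′-refl             = ≤-refl
  mono′ (≤′-step {n} m≤′n) = ≤-trans (mono′ m≤′n) (m≤m+n (n !) (n * n !))

n!≤n^n : ∀ n → n ! ≤ n ^ n
n!≤n^n zero    = ≤-refl
n!≤n^n (suc n) = *-monoʳ-≤ (suc n) (≤-trans (n!≤n^n n) (^-monoˡ-≤ n (n≤1+n n)))

n<2^n : ∀ n → n < 2 ^ n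
n<2^n zero    = ≤-refl
n<2^n (suc n) = +-mono-≤ (m^n>0 2 n) (≤-trans (n<2^n n) (m≤m+n (2 ^ n) 0))

2+n≤n*[1+n] : ∀ {n} → 2 ≤ n → 2 + n ≤ n * suc n
2+n≤n*[1+n] {n@(suc (suc o))} (s≤s (s≤s z≤n)) = begin
  2 + n                      ≤⟨ s≤s (m≤n+m (suc n) n) ⟩
  suc n + suc n              ≤⟨ +-monoʳ-≤ (suc n) (m≤m+n (suc n) (o * suc n)) ⟩
  suc n + (suc n + o * suc n) ∎
  where open ≤-Reasoning

n*[1+n]≤n! : ∀ {n} → 4 ≤ n → n * suc n ≤ n !
n*[1+n]≤n! = go ∘′ ≤⇒≤′
  where
  go : ∀ {n} → 4 ≤′ n → n * suc n ≤ n !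
  go ≤′-refl             = ≤ᵇ⇒≤ 20 24 tt
  go (≤′-step {n} 4≤′n) =
    *-monoʳ-≤ (suc n) (≤-trans (2+n≤n*[1+n] (≤-trans (≤ᵇ⇒≤ 2 4 tt) (≤′⇒≤ 4≤′n))) (go 4≤′n))

φ : ℕ → ℕ → ℕ
φ k n = (k !) ^ n + k ^ (n !)

φ[1,n]<φ[n,1] : ∀ {n} → 1 < n → φ 1 n < φ n 1
φ[1,n]<φ[n,1] {n} 1<n = begin-strict
  φ 1 n          ≡⟨ cong₂ _+_ (^-zeroˡ n) (^-zeroˡ (n !)) ⟩
  1 + 1          <⟨ +-mono-≤-< (1≤n! n) 1<n ⟩
  n ! + n        ≡⟨ sym (cong₂ _+_ (*-identityʳ (n !)) (*-identityʳ n)) ⟩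
  φ n 1          ∎
  where open ≤-Reasoning

5≤n⇒φ[n,k]<k^n! : ∀ {k n} → 5 ≤ n → 2 ≤ k → k < n → φ n k < k ^ (n !)
5≤n⇒φ[n,k]<k^n! {k} {n@(suc m)} (s≤s 4≤m) 2≤k (s≤s k≤m) = begin-strict
  (n !) ^ k + n ^ (k !)      ≤⟨ +-mono-≤ [n!]^k≤2^[mF] n^k!≤2^[mF] ⟩
  2 ^ (m * F) + 2 ^ (m * F)  ≡⟨ cong (2 ^ (m * F) +_) (sym (+-identityʳ (2 ^ (m * F)))) ⟩
  2 ^ suc (m * F)            <⟨ ^-monoʳ-< 2 ≤-refl (+-monoˡ-≤ (m * F) 2≤F) ⟩
  2 ^ (n !)                  ≤⟨ ^-monoˡ-≤ (n !) 2≤k ⟩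
  k ^ (n !)                  ∎
  where
  open ≤-Reasoning
  F = m !
  m*n≤F : m * n ≤ F
  m*n≤F = n*[1+n]≤n! 4≤m
  2≤F : 2 ≤ F
  2≤F = !-mono-≤ (≤-trans (≤ᵇ⇒≤ 2 4 tt) 4≤m)
  n^F≤2^[mF] : n ^ F ≤ 2 ^ (m * F)
  n^F≤2^[mF] = begin
    n ^ F        ≤⟨ ^-monoˡ-≤ F (n<2^n m) ⟩
    (2 ^ m) ^ F  ≡⟨ ^-*-assoc 2 m F ⟩
    2 ^ (m * F)  ∎
  [n!]^k≤2^[mF] : (n !) ^ k ≤ 2 ^ (m * F)
  [n!]^k≤2^[mF] = begin
    (n !) ^ k    ≤⟨ ^-monoʳ-≤ (n !) {{n !≢0}} k≤m ⟩
    (n !) ^ m    ≤⟨ ^-monoˡ-≤ m (n!≤n^n n) ⟩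
    (n ^ n) ^ m  ≡⟨ ^-*-assoc n n m ⟩
    n ^ (n * m)  ≤⟨ ^-monoʳ-≤ n (≤-trans (≤-reflexive (*-comm n m)) m*n≤F) ⟩
    n ^ F        ≤⟨ n^F≤2^[mF] ⟩
    2 ^ (m * F)  ∎
  n^k!≤2^[mF] : n ^ (k !) ≤ 2 ^ (m * F)
  n^k!≤2^[mF] = ≤-trans (^-monoʳ-≤ n (!-mono-≤ k≤m)) n^F≤2^[mF]

φ[n,k]<k^n! : ∀ {k n} → 2 ≤ k → k < n → φ n k < k ^ (n !)
φ[n,k]<k^n! (s≤s (s≤s _)) (s≤s (s≤s (s≤s j≤m))) = cases j≤m
  where
  cases : ∀ {j m} → j ≤ m → φ (3 + m) (2 + j) < (2 + j) ^ ((3 + m) !)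
  cases {0}           {0} _        = <ᵇ⇒< _ _ tt
  cases {0}           {1} _        = <ᵇ⇒< _ _ tt
  cases {1}           {1} _        = <ᵇ⇒< _ _ tt
  cases {suc (suc _)} {1} (s≤s ())
  cases {m = suc (suc _)} j≤m =
    5≤n⇒φ[n,k]<k^n! (s≤s (s≤s (s≤s (s≤s (s≤s z≤n))))) (s≤s (s≤s z≤n)) (s≤s (s≤s (s≤s j≤m)))

k<n⇒φ[k,n]≢φ[n,k] : ∀ {k n} → 1 ≤ k → k < n → φ k n ≢ φ n k
k<n⇒φ[k,n]≢φ[n,k] {1}           _ 1<n eq = <-irrefl eq (φ[1,n]<φ[n,1] 1<n)
k<n⇒φ[k,n]≢φ[n,k] {suc (suc _)} _ k<n eq =
  <-irrefl (sym eq) (<-≤-trans (φ[n,k]<k^n! (s≤s (s≤s z≤n)) k<n) (m≤n+m _ _))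

theorem1p4 : (n k : ℕ) → 1 ≤ n → 1 ≤ k →
    (((k !) ^ n + k ^ (n !) ≡ (n !) ^ k + n ^ (k !)) ⇔ (k ≡ n))
theorem1p4 n k 1≤n 1≤k = mk⇔ to from
  where
  to : φ k n ≡ φ n k → k ≡ n
  to eq with <-cmp k n
  ... | tri< k<n _ _ = contradiction eq (k<n⇒φ[k,n]≢φ[n,k] 1≤k k<n)
  ... | tri≈ _ k≡n _ = k≡n
  ... | tri> _ _ n<k = contradiction (sym eq) (k<n⇒φ[k,n]≢φ[n,k] 1≤n n<k)
  from : k ≡ n → φ k n ≡ φ n k
  from refl = refl
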